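{- Let $K$ be a field of characteristic zero with algebraic closure $\bar K$. For $u \in \bar K \setminus \{ -1,-2\}$ define $$f_u(z) = \frac{z^2(z+u)}{(2u+3)z - (u+2)}.$$ Every cubic rational function $f \in \bar K(z)$ having $0$, $1$, and $\infty$ among its critical points is equivalent to $f_u$ for a unique $u \in \bar K \setminus \{ -1,-2\}$, and the fourth critical point of $f_u$ is $\phi(u) = -\frac{u^2+2u}{2u+3}$.
   Context: Two rational functions $f,g \in \bar K(z)$ are called equivalent if there is a fractional linear transformation $\sigma \in \bar K(z)$ such that $f = \sigma \circ g$. The critical points of a rational function are the points of $\mathbb{P}^1(\bar K)$ at which it is not locally injective; a cubic rational function has four critical points counted with multiplicity. -}

module Defs where

open import Level using (Level; _⊔_)
open import Data.Nat using (ℕ; zero; suc; _<_; _∸_)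
open import Data.Fin as Fin using (Fin)
open import Data.Product using (Σ; ∃; _×_; _,_)
open import Relation.Nullary using (¬_)
open import Algebra.Bundles using (CommutativeRing)

module RingOps {c ℓ : Level} (R : CommutativeRing c ℓ) where
  open CommutativeRing R
  _·1 : ℕ → Carrier
  zero  ·1 = 0#
  suc n ·1 = 1# + (n ·1)
  evalUpTo : (ℕ → Carrier) → ℕ → Carrier → Carrier
  evalUpTo a zero    x = a 0
  evalUpTo a (suc n) x = a 0 + x * evalUpTo (λ i → a (suc i)) n x

-- An algebraically closed field of characteristic zero (playing the role of K̄).
record ACField0 (c ℓ : Level) : Set (Level.suc (c ⊔ ℓ)) where
  field
    commRing : CommutativeRing c ℓ
  open CommutativeRing commRing public
  open RingOps commRing public
  field
    1≉0        : ¬ (1# ≈ 0#)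
    inverse    : ∀ x → ¬ (x ≈ 0#) → Σ Carrier λ y → x * y ≈ 1#
    charZero   : ∀ n → ¬ (suc n ·1 ≈ 0#)
    algClosed  : ∀ (n : ℕ) (a : ℕ → Carrier) → ¬ (a (suc n) ≈ 0#) →
                 Σ Carrier λ x → evalUpTo a (suc n) x ≈ 0#

module Theory {c ℓ : Level} (F : ACField0 c ℓ) where
  open ACField0 F

  -- Polynomials in z over K̄, as coefficient sequences (coefficient of z^i);
  -- all polynomials used below have finite support by construction.
  Poly : Set c
  Poly = ℕ → Carrier

  _≈P_ : Poly → Poly → Set ℓ
  p ≈P q = ∀ n → p n ≈ q n

  _+P_ : Poly → Poly → Poly
  (p +P q) n = p n + q n

  _-P_ : Poly → Poly → Poly
  (p -P q) n = p n - q n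

  _·P_ : Carrier → Poly → Poly
  (a ·P p) n = a * p n

  sumTo : ℕ → (ℕ → Carrier) → Carrier
  sumTo zero    g = g 0
  sumTo (suc n) g = g 0 + sumTo n (λ i → g (suc i))

  _*P_ : Poly → Poly → Poly
  (p *P q) n = sumTo n (λ i → p i * q (n ∸ i))

  deriv : Poly → Poly
  deriv p n = (suc n ·1) * p (suc n)

  cub : Carrier → Carrier → Carrier → Carrier → Poly
  cub a0 a1 a2 a3 0 = a0
  cub a0 a1 a2 a3 1 = a1
  cub a0 a1 a2 a3 2 = a2
  cub a0 a1 a2 a3 3 = a3
  cub a0 a1 a2 a3 (suc (suc (suc (suc _)))) = 0#

  lin : Carrier → Carrier → Poly
  lin a0 a1 = cub a0 a1 0# 0#

  ev : Poly → Carrier → Carrier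
  ev p x = evalUpTo p 3 x

  record RatFun : Set c where
    constructor _/_
    field
      num : Fin 4 → Carrier
      den : Fin 4 → Carrier
    P : Poly
    P = cub (num Fin.zero) (num (Fin.suc Fin.zero)) (num (Fin.suc (Fin.suc Fin.zero))) (num (Fin.suc (Fin.suc (Fin.suc Fin.zero))))
    Q : Poly
    Q = cub (den Fin.zero) (den (Fin.suc Fin.zero)) (den (Fin.suc (Fin.suc Fin.zero))) (den (Fin.suc (Fin.suc (Fin.suc Fin.zero))))
  open RatFun public

  -- f = P/Q is cubic: P and Q have no common zero in K̄ (i.e. gcd(P,Q) = 1, K̄ being
  -- algebraically closed) and max(deg P, deg Q) = 3.
  IsCubic : RatFun → Set (c ⊔ ℓ)
  IsCubic f = (¬ (P f 3 ≈ 0# × Q f 3 ≈ 0#)) ×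
              (∀ x → ¬ (ev (P f) x ≈ 0# × ev (Q f) x ≈ 0#))

  data P¹ : Set c where
    fin : Carrier → P¹
    ∞   : P¹

  -- Wronskian P'Q - PQ'; for a cubic f it is viewed as a binary form of degree 4
  -- (2·deg f - 2), whose zeros in P¹ (with multiplicity) are the critical points of f.
  wronskian : RatFun → Poly
  wronskian f = (deriv (P f) *P Q f) -P (P f *P deriv (Q f))

  Critical : RatFun → P¹ → Set ℓ
  Critical f (fin a) = ev4 (wronskian f) a ≈ 0#
    where ev4 : Poly → Carrier → Carrier
          ev4 p x = evalUpTo p 4 x
  Critical f ∞       = wronskian f 4 ≈ 0#

  -- f = σ ∘ g for a fractional linear transformation σ(w) = (a w + b)/(c w + d), ad - bc ≠ 0;
  -- equality in K̄(z): P_f · (c P_g + d Q_g) = Q_f · (a P_g + b Q_g).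
  Equivalent : RatFun → RatFun → Set (c ⊔ ℓ)
  Equivalent f g = Σ Carrier λ a → Σ Carrier λ b → Σ Carrier λ c' → Σ Carrier λ d →
    (¬ (a * d - b * c' ≈ 0#)) ×
    ((P f *P ((c' ·P P g) +P (d ·P Q g))) ≈P (Q f *P ((a ·P P g) +P (b ·P Q g))))

  two three : Carrier
  two = 2 ·1
  three = 3 ·1

  Admissible : Carrier → Set ℓ
  Admissible u = ¬ (u ≈ - 1#) × ¬ (u ≈ - two)

  fᵤ : Carrier → RatFun
  fᵤ u = n / d
    where
      n : Fin 4 → Carrier
      n Fin.zero = 0#
      n (Fin.suc Fin.zero) = 0#
      n (Fin.suc (Fin.suc Fin.zero)) = u
      n (Fin.suc (Fin.suc (Fin.suc Fin.zero))) = 1#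
      d : Fin 4 → Carrier
      d Fin.zero = - (u + two)
      d (Fin.suc Fin.zero) = two * u + three
      d (Fin.suc (Fin.suc Fin.zero)) = 0#
      d (Fin.suc (Fin.suc (Fin.suc Fin.zero))) = 0#

  -- The critical points of f_u, with multiplicity, are 0, 1, ∞ and
  -- φ(u) = -(u²+2u)/(2u+3) = [-(u²+2u) : 2u+3] ∈ P¹:
  -- the degree-4 Wronskian form is a nonzero multiple of X·(X-Y)·Y·((2u+3)X + (u²+2u)Y).
  -- Dehomogenised (Y = 1): c · z · (z - 1) · ((2u+3) z + (u²+2u)), with zero z⁴-coefficient (root at ∞).
  CriticalPoints-0-1-∞-φ : Carrier → Set (c ⊔ ℓ)
  CriticalPoints-0-1-∞-φ u =
    Σ Carrier λ k → ¬ (k ≈ 0#) ×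
      (wronskian (fᵤ u) ≈P
        (k ·P ((lin 0# 1# *P lin (- 1#) 1#) *P lin (u * u + two * u) (two * u + three))))

module Submission where

-- Write f = P/Q with P = Σ pᵢzⁱ, Q = Σ qᵢzⁱ (i ≤ 3).  Composing f with a
-- fractional linear transformation replaces (P, Q) by two members of the
-- pencil s·P + t·Q, and for a cubic f no nontrivial member of the pencil is
-- the zero polynomial (P, Q have no common root and K̄ is algebraically closed).
--
-- Existence.  The members A = q₀P - p₀Q and B = p₃Q - q₃P send 0 ↦ 0 and
-- ∞ ↦ ∞.  Criticality at 0 and ∞ (vanishing of the Wronskian P'Q - PQ' there)
-- forces A = z²(A₂ + A₃z) and B = B₀ + B₁z, with A₃ = B₀ = ν = q₀p₃ - p₀q₃ ≠ 0.
-- Criticality at 1 gives A(1), B(1) ≠ 0 (a pencil member cannot have a simple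
-- zero at a critical point) and A'(1)B(1) = A(1)B'(1); rescaling A and B then
-- yields exactly the numerator and denominator of f_u with u = A₂/A₃.
-- Uniqueness.  If f = σ∘f_{u'}, then σ⁻¹ turns (P, Q) into pencil members
-- with D'·(d'P - b'Q) = N'·(a'Q - c'P), N' = z²(z+u'), D' = (2u'+3)z - (u'+2);
-- comparing coefficients and evaluating at z = -u' gives A(-u') = 0, so u' = u.

open import Defs
open import Level using (Level)
open import Data.Product using (Σ; _×_; _,_; proj₁; proj₂)
open import Algebra.Bundles using (CommutativeRing; RawRing)
open import Data.Nat as ℕ using (ℕ; zero; suc; _∸_; _≤_; _<_; z≤n; s≤s)
import Data.Nat.Properties as ℕP
open import Data.Integer as ℤ using (ℤ; +_; -[1+_]; _⊖_; sign; ∣_∣; _◃_)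
import Data.Integer.Properties as ℤP
open import Data.Sign as Sign using (Sign)
open import Data.Maybe using (Maybe; just; nothing)
open import Data.Vec.N-ary using (N-ary)
open import Relation.Binary.PropositionalEquality as PE using (_≡_)
open import Relation.Nullary using (yes; no; ¬_)
import Algebra.Solver.Ring.AlmostCommutativeRing as ACR
open import Data.Sum using (_⊎_; inj₁; inj₂)
open import Data.Empty using (⊥)

module IntegerCoefficients {c ℓ : Level} (R : CommutativeRing c ℓ) where
  open CommutativeRing R
  open import Algebra.Properties.Ring ring using (-0#≈0#; -‿involutive; -‿distribˡ-*; -‿distribʳ-*)
  open import Algebra.Properties.AbelianGroup +-abelianGroup using (⁻¹-∙-comm)
  open import Algebra.Properties.Semiring.Mult.TCOptimised semiring
    using (1+×; ×-homo-+; ×1-homo-*) renaming (_×_ to _·_)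
  open import Relation.Binary.Reasoning.Setoid setoid

  -- the image of an integer; 0 and 1 go definitionally to 0# and 1#, so that the
  -- numerals of solver expressions denote exactly the `n ·1` used in Defs
  ⟦_⟧ℤ : ℤ → Carrier
  ⟦ + n ⟧ℤ = n · 1#
  ⟦ -[1+ n ] ⟧ℤ = - (suc n · 1#)

  -- (the ring manipulations here are done by hand: the solver is not yet available)
  ⊖-homo : ∀ m n → ⟦ m ⊖ n ⟧ℤ ≈ m · 1# - n · 1#
  ⊖-homo m zero = sym (trans (+-congˡ -0#≈0#) (+-identityʳ _))
  ⊖-homo zero (suc n) = sym (+-identityˡ _)
  ⊖-homo (suc m) (suc n) = begin
    ⟦ suc m ⊖ suc n ⟧ℤ                 ≡⟨ PE.cong ⟦_⟧ℤ (ℤP.[1+m]⊖[1+n]≡m⊖n m n) ⟩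
    ⟦ m ⊖ n ⟧ℤ                         ≈⟨ ⊖-homo m n ⟩
    x + - y                            ≈⟨ +-congʳ (sym (+-identityˡ _)) ⟩
    (0# + x) + - y                     ≈⟨ +-congʳ (+-congʳ (sym (-‿inverseʳ 1#))) ⟩
    ((1# + - 1#) + x) + - y            ≈⟨ +-congʳ (+-assoc _ _ _) ⟩
    (1# + (- 1# + x)) + - y            ≈⟨ +-congʳ (+-congˡ (+-comm _ _)) ⟩
    (1# + (x + - 1#)) + - y            ≈⟨ +-congʳ (sym (+-assoc _ _ _)) ⟩
    ((1# + x) + - 1#) + - y            ≈⟨ +-assoc _ _ _ ⟩
    (1# + x) + (- 1# + - y)            ≈⟨ +-congˡ (⁻¹-∙-comm _ _) ⟩
    (1# + x) + - (1# + y)              ≈⟨ +-cong (sym (1+× m 1#)) (-‿cong (sym (1+× n 1#))) ⟩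
    suc m · 1# + - (suc n · 1#)        ∎
    where
    x y : Carrier
    x = m · 1#
    y = n · 1#

  +-homo : ∀ i j → ⟦ i ℤ.+ j ⟧ℤ ≈ ⟦ i ⟧ℤ + ⟦ j ⟧ℤ
  +-homo -[1+ m ] -[1+ n ] = begin
    - (suc (suc (m ℕ.+ n)) · 1#)        ≡⟨ PE.cong (λ k → - (k · 1#)) (PE.sym (ℕP.+-suc (suc m) n)) ⟩
    - ((suc m ℕ.+ suc n) · 1#)          ≈⟨ -‿cong (×-homo-+ 1# (suc m) (suc n)) ⟩
    - (suc m · 1# + suc n · 1#)         ≈⟨ sym (⁻¹-∙-comm _ _) ⟩
    - (suc m · 1#) + - (suc n · 1#)     ∎
  +-homo -[1+ m ] (+ n) = trans (⊖-homo n (suc m)) (+-comm _ _)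
  +-homo (+ m) -[1+ n ] = ⊖-homo m (suc n)
  +-homo (+ m) (+ n) = ×-homo-+ 1# m n

  signed : Sign → Carrier → Carrier
  signed Sign.+ x = x
  signed Sign.- x = - x

  signed-cong : ∀ s {x y} → x ≈ y → signed s x ≈ signed s y
  signed-cong Sign.+ e = e
  signed-cong Sign.- e = -‿cong e

  signed-* : ∀ s t x y → signed (s Sign.* t) (x * y) ≈ signed s x * signed t y
  signed-* Sign.- Sign.- x y = begin
    x * y           ≈⟨ sym (-‿involutive _) ⟩
    - - (x * y)     ≈⟨ -‿cong (-‿distribʳ-* x y) ⟩
    - (x * - y)     ≈⟨ -‿distribˡ-* x (- y) ⟩
    - x * - y       ∎
  signed-* Sign.- Sign.+ x y = -‿distribˡ-* x y
  signed-* Sign.+ Sign.- x y = -‿distribʳ-* x y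
  signed-* Sign.+ Sign.+ x y = refl

  ◃-homo : ∀ s n → ⟦ s ◃ n ⟧ℤ ≈ signed s (n · 1#)
  ◃-homo Sign.- zero = sym -0#≈0#
  ◃-homo Sign.+ zero = refl
  ◃-homo Sign.+ (suc n) = refl
  ◃-homo Sign.- (suc n) = refl

  sign-abs : ∀ i → ⟦ i ⟧ℤ ≈ signed (sign i) (∣ i ∣ · 1#)
  sign-abs (+ n) = refl
  sign-abs -[1+ n ] = refl

  *-homo : ∀ i j → ⟦ i ℤ.* j ⟧ℤ ≈ ⟦ i ⟧ℤ * ⟦ j ⟧ℤ
  *-homo i j = begin
    ⟦ i ℤ.* j ⟧ℤ                                       ≈⟨ ◃-homo s (∣ i ∣ ℕ.* ∣ j ∣) ⟩
    signed s ((∣ i ∣ ℕ.* ∣ j ∣) · 1#)                   ≈⟨ signed-cong s (×1-homo-* ∣ i ∣ ∣ j ∣) ⟩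
    signed s ((∣ i ∣ · 1#) * (∣ j ∣ · 1#))              ≈⟨ signed-* (sign i) (sign j) _ _ ⟩
    signed (sign i) (∣ i ∣ · 1#) * signed (sign j) (∣ j ∣ · 1#) ≈⟨ *-cong (sym (sign-abs i)) (sym (sign-abs j)) ⟩
    ⟦ i ⟧ℤ * ⟦ j ⟧ℤ                                    ∎
    where
    s : Sign
    s = sign i Sign.* sign j

  neg-homo : ∀ i → ⟦ ℤ.- i ⟧ℤ ≈ - ⟦ i ⟧ℤ
  neg-homo (+ zero) = sym -0#≈0#
  neg-homo (+ suc n) = refl
  neg-homo -[1+ n ] = sym (-‿involutive _)

  ℤ-rawRing : RawRing Level.zero Level.zero
  ℤ-rawRing = record { Carrier = ℤ ; _≈_ = _≡_ ; _+_ = ℤ._+_ ; _*_ = ℤ._*_ ; -_ = ℤ.-_ ; 0# = + 0 ; 1# = + 1 }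

  R-almostCommutative : ACR.AlmostCommutativeRing c ℓ
  R-almostCommutative = ACR.fromCommutativeRing R

  ℤ⟶R : ℤ-rawRing ACR.-Raw-AlmostCommutative⟶ R-almostCommutative
  ℤ⟶R = record
    { ⟦_⟧ = ⟦_⟧ℤ ; +-homo = +-homo ; *-homo = *-homo ; -‿homo = neg-homo
    ; 0-homo = refl ; 1-homo = refl }

  ℤ-equal? : ∀ i j → Maybe (⟦ i ⟧ℤ ≈ ⟦ j ⟧ℤ)
  ℤ-equal? i j with i ℤ.≟ j
  ... | yes PE.refl = just refl
  ... | no _ = nothing

  open import Algebra.Solver.Ring ℤ-rawRing R-almostCommutative ℤ⟶R ℤ-equal? public
    using (Polynomial; solve; _:=_; _:+_; _:*_; _:-_; :-_; con)

  -- the numeral n as an expression; it denotes 1# + (1# + … + 0#), that is n ·1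
  lit : ∀ {m} → ℕ → Polynomial m
  lit zero = con (+ 0)
  lit (suc n) = con (+ 1) :+ lit n

-- Expression counterparts of the coefficient-sequence operations of Defs;
-- they denote the same ring elements, so that coefficient identities can be
-- checked by the solver.
module CoefficientExpressions {c ℓ : Level} (R : CommutativeRing c ℓ) {m : ℕ} where
  open IntegerCoefficients R using (Polynomial; _:+_; _:*_; _:-_; lit)

  Expr : Set
  Expr = Polynomial m

  cubₑ : Expr → Expr → Expr → Expr → ℕ → Expr
  cubₑ a0 a1 a2 a3 0 = a0
  cubₑ a0 a1 a2 a3 1 = a1
  cubₑ a0 a1 a2 a3 2 = a2
  cubₑ a0 a1 a2 a3 3 = a3
  cubₑ a0 a1 a2 a3 (suc (suc (suc (suc _)))) = lit 0

  sumToₑ : ℕ → (ℕ → Expr) → Expr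
  sumToₑ zero g = g 0
  sumToₑ (suc n) g = g 0 :+ sumToₑ n (λ i → g (suc i))

  _*ₑ_ _+ₑ_ _-ₑ_ : (ℕ → Expr) → (ℕ → Expr) → ℕ → Expr
  (p *ₑ q) n = sumToₑ n (λ i → p i :* q (n ∸ i))
  (p +ₑ q) n = p n :+ q n
  (p -ₑ q) n = p n :- q n

  _·ₑ_ : Expr → (ℕ → Expr) → ℕ → Expr
  (a ·ₑ p) n = a :* p n

  derivₑ : (ℕ → Expr) → ℕ → Expr
  derivₑ p n = lit (suc n) :* p (suc n)

  wronskianₑ : (ℕ → Expr) → (ℕ → Expr) → ℕ → Expr
  wronskianₑ p q = (derivₑ p *ₑ q) -ₑ (p *ₑ derivₑ q)

  evalₑ : (ℕ → Expr) → ℕ → Expr → Expr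
  evalₑ a zero x = a 0
  evalₑ a (suc n) x = a 0 :+ x :* evalₑ (λ i → a (suc i)) n x

  linₑ : Expr → Expr → ℕ → Expr
  linₑ a0 a1 = cubₑ a0 a1 (lit 0) (lit 0)

  pencilₑ : Expr → Expr → Expr → Expr → Expr
  pencilₑ s t x y = s :* x :+ t :* y

  value-at-1ₑ slope-at-1ₑ : Expr → Expr → Expr → Expr → Expr
  value-at-1ₑ a0 a1 a2 a3 = a0 :+ a1 :+ a2 :+ a3
  slope-at-1ₑ a0 a1 a2 a3 = a1 :+ lit 2 :* a2 :+ lit 3 :* a3

module FieldFacts {c ℓ : Level} (F : ACField0 c ℓ) where
  open ACField0 F
  open IntegerCoefficients commRing
  open CoefficientExpressions commRing using (value-at-1ₑ; slope-at-1ₑ)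
  open import Relation.Binary.Reasoning.Setoid setoid

  -- case distinction on an (undecided) equation, when the goal is ⊥
  byCases : ∀ {a} {X : Set a} → (X → ⊥) → (¬ X → ⊥) → ⊥
  byCases x⇒⊥ ¬x⇒⊥ = ¬x⇒⊥ x⇒⊥

  sum≈0 : ∀ {x y} → x ≈ 0# → y ≈ 0# → x + y ≈ 0#
  sum≈0 x≈0 y≈0 = trans (+-cong x≈0 y≈0) (+-identityˡ 0#)

  diff≈0 : ∀ {x y} → x ≈ 0# → y ≈ 0# → x - y ≈ 0#
  diff≈0 {x} {y} x≈0 y≈0 =
    trans (+-cong x≈0 (-‿cong y≈0)) (solve 0 (lit 0 :+ :- lit 0 := lit 0) refl)

  mulˡ≈0 : ∀ m {x} → x ≈ 0# → m * x ≈ 0#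
  mulˡ≈0 m x≈0 = trans (*-congˡ x≈0) (zeroʳ m)

  mulʳ≈0 : ∀ m {x} → x ≈ 0# → x * m ≈ 0#
  mulʳ≈0 m x≈0 = trans (*-congʳ x≈0) (zeroˡ m)

  x≈y⇒x-y≈0 : ∀ {x y} → x ≈ y → x - y ≈ 0#
  x≈y⇒x-y≈0 {x} {y} x≈y = trans (+-congʳ x≈y) (solve 1 (λ Y → Y :- Y := lit 0) refl y)

  x-y≈0⇒x≈y : ∀ {x y} → x - y ≈ 0# → x ≈ y
  x-y≈0⇒x≈y {x} {y} x-y≈0 = begin
    x            ≈⟨ solve 2 (λ X Y → X := (X :- Y) :+ Y) refl x y ⟩
    (x - y) + y  ≈⟨ +-congʳ x-y≈0 ⟩
    0# + y       ≈⟨ +-identityˡ y ⟩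
    y            ∎

  -x≈0⇒x≈0 : ∀ {x} → - x ≈ 0# → x ≈ 0#
  -x≈0⇒x≈0 {x} -x≈0 = begin
    x      ≈⟨ solve 1 (λ X → X := :- (:- X)) refl x ⟩
    - - x  ≈⟨ -‿cong -x≈0 ⟩
    - 0#   ≈⟨ solve 0 (:- lit 0 := lit 0) refl ⟩
    0#     ∎

  x+y≈0⇒x≈-y : ∀ {x y} → x + y ≈ 0# → x ≈ - y
  x+y≈0⇒x≈-y {x} {y} x+y≈0 = x-y≈0⇒x≈y (trans (solve 2 (λ X Y → X :- :- Y := X :+ Y) refl x y) x+y≈0)

  sum≈0-cancelʳ : ∀ {x y} → x + y ≈ 0# → y ≈ 0# → x ≈ 0#
  sum≈0-cancelʳ {x} {y} x+y≈0 y≈0 =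
    trans (solve 2 (λ X Y → X := (X :+ Y) :- Y) refl x y) (diff≈0 x+y≈0 y≈0)

  sum≈0-cancelˡ : ∀ {x y} → x + y ≈ 0# → x ≈ 0# → y ≈ 0#
  sum≈0-cancelˡ {x} {y} x+y≈0 = sum≈0-cancelʳ (trans (+-comm y x) x+y≈0)

  cancelˡ : ∀ {x y} → ¬ (x ≈ 0#) → x * y ≈ 0# → y ≈ 0#
  cancelˡ {x} {y} x≉0 xy≈0 with inverse x x≉0
  ... | x⁻¹ , xx⁻¹≈1 = begin
    y               ≈⟨ sym (*-identityˡ y) ⟩
    1# * y          ≈⟨ *-congʳ (sym xx⁻¹≈1) ⟩
    (x * x⁻¹) * y   ≈⟨ solve 3 (λ X Y Z → (X :* Z) :* Y := Z :* (X :* Y)) refl x y x⁻¹ ⟩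
    x⁻¹ * (x * y)   ≈⟨ mulˡ≈0 x⁻¹ xy≈0 ⟩
    0#              ∎

  *-nonzero : ∀ {x y} → ¬ (x ≈ 0#) → ¬ (y ≈ 0#) → ¬ (x * y ≈ 0#)
  *-nonzero x≉0 y≉0 xy≈0 = y≉0 (cancelˡ x≉0 xy≈0)

  inverse-nonzero : ∀ {x y} → x * y ≈ 1# → ¬ (y ≈ 0#)
  inverse-nonzero {x} xy≈1 y≈0 = 1≉0 (trans (sym xy≈1) (mulˡ≈0 x y≈0))

  all-coefficients : ∀ {r : ℕ → Carrier} → r 0 ≈ 0# → r 1 ≈ 0# → r 2 ≈ 0# → r 3 ≈ 0# → ∀ i → i ≤ 3 → r i ≈ 0#
  all-coefficients r0 r1 r2 r3 0 _ = r0
  all-coefficients r0 r1 r2 r3 1 _ = r1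
  all-coefficients r0 r1 r2 r3 2 _ = r2
  all-coefficients r0 r1 r2 r3 3 _ = r3
  all-coefficients r0 r1 r2 r3 (suc (suc (suc (suc _)))) (s≤s (s≤s (s≤s ())))

  value-at-1 slope-at-1 : (ℕ → Carrier) → Carrier
  value-at-1 r = r 0 + r 1 + r 2 + r 3
  slope-at-1 r = r 1 + 2 ·1 * r 2 + 3 ·1 * r 3

  -- A cubic with a double zero at 1 is (z - 1)²(c₀ + c₁z); hence it vanishes
  -- as soon as its two lower, or its two upper, coefficients vanish.
  double-zero-at-1 : ∀ (r : ℕ → Carrier) → value-at-1 r ≈ 0# → slope-at-1 r ≈ 0# →
    (r 0 ≈ 0# × r 1 ≈ 0#) ⊎ (r 2 ≈ 0# × r 3 ≈ 0#) → ∀ i → i ≤ 3 → r i ≈ 0#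
  double-zero-at-1 r v v′ (inj₁ (r0 , r1)) = all-coefficients r0 r1 r2 r3
    where
    r2 : r 2 ≈ 0#
    r2 = trans (solve 4 (λ R0 R1 R2 R3 → R2 := lit 3 :* value-at-1ₑ R0 R1 R2 R3 :- slope-at-1ₑ R0 R1 R2 R3 :- lit 3 :* R0 :- lit 2 :* R1)
                        refl (r 0) (r 1) (r 2) (r 3))
               (diff≈0 (diff≈0 (diff≈0 (mulˡ≈0 _ v) v′) (mulˡ≈0 _ r0)) (mulˡ≈0 _ r1))
    r3 : r 3 ≈ 0#
    r3 = trans (solve 4 (λ R0 R1 R2 R3 → R3 := slope-at-1ₑ R0 R1 R2 R3 :- lit 2 :* value-at-1ₑ R0 R1 R2 R3 :+ lit 2 :* R0 :+ R1)
                        refl (r 0) (r 1) (r 2) (r 3))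
               (sum≈0 (sum≈0 (diff≈0 v′ (mulˡ≈0 _ v)) (mulˡ≈0 _ r0)) r1)
  double-zero-at-1 r v v′ (inj₂ (r2 , r3)) = all-coefficients r0 r1 r2 r3
    where
    r0 : r 0 ≈ 0#
    r0 = trans (solve 4 (λ R0 R1 R2 R3 → R0 := value-at-1ₑ R0 R1 R2 R3 :- slope-at-1ₑ R0 R1 R2 R3 :+ R2 :+ lit 2 :* R3)
                        refl (r 0) (r 1) (r 2) (r 3))
               (sum≈0 (sum≈0 (diff≈0 v v′) r2) (mulˡ≈0 _ r3))
    r1 : r 1 ≈ 0#
    r1 = trans (solve 4 (λ R0 R1 R2 R3 → R1 := slope-at-1ₑ R0 R1 R2 R3 :- lit 2 :* R2 :- lit 3 :* R3)
                        refl (r 0) (r 1) (r 2) (r 3))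
               (diff≈0 (diff≈0 v′ (mulˡ≈0 _ r2)) (mulˡ≈0 _ r3))


module Polynomials {c ℓ : Level} (F : ACField0 c ℓ) where
  open ACField0 F
  open Theory F
  open FieldFacts F
  open IntegerCoefficients commRing
  open CoefficientExpressions commRing

  sumTo-cong : ∀ n {g h : ℕ → Carrier} → (∀ i → g i ≈ h i) → sumTo n g ≈ sumTo n h
  sumTo-cong zero g≈h = g≈h 0
  sumTo-cong (suc n) g≈h = +-cong (g≈h 0) (sumTo-cong n (λ i → g≈h (suc i)))

  sumTo-zero : ∀ n (g : ℕ → Carrier) → (∀ i → i ≤ n → g i ≈ 0#) → sumTo n g ≈ 0#
  sumTo-zero zero g g≈0 = g≈0 0 z≤n
  sumTo-zero (suc n) g g≈0 = sum≈0 (g≈0 0 z≤n) (sumTo-zero n (λ i → g (suc i)) (λ i i≤n → g≈0 (suc i) (s≤s i≤n)))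

  *P-congʳ : ∀ p {q q′} → q ≈P q′ → (p *P q) ≈P (p *P q′)
  *P-congʳ p q≈q′ n = sumTo-cong n (λ i → *-congˡ (q≈q′ (n ∸ i)))

  DegreeAtMost : ℕ → Poly → Set ℓ
  DegreeAtMost d p = ∀ i → d < i → p i ≈ 0#

  *P-degree : ∀ {dp dq p q} → DegreeAtMost dp p → DegreeAtMost dq q → DegreeAtMost (dp ℕ.+ dq) (p *P q)
  *P-degree {dp} {dq} {p} {q} p-deg q-deg n dp+dq<n = sumTo-zero n _ term≈0
    where
    -- in every term pᵢ q_{n-i}, either i > dp or n - i > dq
    term≈0 : ∀ i → i ≤ n → p i * q (n ∸ i) ≈ 0#
    term≈0 i i≤n with i ℕ.≤? dp
    ... | yes i≤dp = mulˡ≈0 (p i) (q-deg (n ∸ i) (dq<n∸i i n (ℕP.≤-<-trans (ℕP.+-monoˡ-≤ dq i≤dp) dp+dq<n)))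
      where
      dq<n∸i : ∀ i n → i ℕ.+ dq < n → dq < n ∸ i
      dq<n∸i zero n lt = lt
      dq<n∸i (suc i) (suc n) (s≤s lt) = dq<n∸i i n lt
    ... | no i≰dp = mulʳ≈0 (q (n ∸ i)) (p-deg i (ℕP.≰⇒> i≰dp))

  deriv-degree : ∀ {d p} → DegreeAtMost (suc d) p → DegreeAtMost d (deriv p)
  deriv-degree p-deg i d<i = mulˡ≈0 _ (p-deg (suc i) (s≤s d<i))

  ·P-degree : ∀ {d} k {p} → DegreeAtMost d p → DegreeAtMost d (k ·P p)
  ·P-degree k p-deg i d<i = mulˡ≈0 k (p-deg i d<i)

  -P-degree : ∀ {d p q} → DegreeAtMost d p → DegreeAtMost d q → DegreeAtMost d (p -P q)
  -P-degree p-deg q-deg i d<i = diff≈0 (p-deg i d<i) (q-deg i d<i)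

  cub-degree : ∀ a0 a1 a2 a3 → DegreeAtMost 3 (cub a0 a1 a2 a3)
  cub-degree a0 a1 a2 a3 (suc (suc (suc (suc i)))) _ = refl
  cub-degree a0 a1 a2 a3 (suc zero) (s≤s ())
  cub-degree a0 a1 a2 a3 (suc (suc zero)) (s≤s (s≤s ()))
  cub-degree a0 a1 a2 a3 (suc (suc (suc zero))) (s≤s (s≤s (s≤s ())))

  lin-degree : ∀ a0 a1 → DegreeAtMost 1 (lin a0 a1)
  lin-degree a0 a1 (suc (suc zero)) _ = refl
  lin-degree a0 a1 (suc (suc (suc zero))) _ = refl
  lin-degree a0 a1 (suc (suc (suc (suc i)))) _ = refl
  lin-degree a0 a1 (suc zero) (s≤s ())

  ≈P-from-low : ∀ d {p q} → DegreeAtMost d p → DegreeAtMost d q → (∀ n → n ≤ d → p n ≈ q n) → p ≈P q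
  ≈P-from-low d p-deg q-deg low n with n ℕ.≤? d
  ... | yes n≤d = low n n≤d
  ... | no n≰d = trans (p-deg n (ℕP.≰⇒> n≰d)) (sym (q-deg n (ℕP.≰⇒> n≰d)))

  cub-*P-comm : ∀ k a0 a1 a2 a3 b0 b1 b2 b3 →
    (cub a0 a1 a2 a3 *P (k ·P cub b0 b1 b2 b3)) ≈P (cub b0 b1 b2 b3 *P (k ·P cub a0 a1 a2 a3))
  cub-*P-comm k a0 a1 a2 a3 b0 b1 b2 b3 =
    ≈P-from-low 6 (*P-degree {3} {3} (cub-degree _ _ _ _) (·P-degree k (cub-degree _ _ _ _)))
                  (*P-degree {3} {3} (cub-degree _ _ _ _) (·P-degree k (cub-degree _ _ _ _))) low
    where
    commute : ℕ → N-ary 9 (Polynomial 9) (Polynomial 9 × Polynomial 9)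
    commute n K A0 A1 A2 A3 B0 B1 B2 B3 =
      (cubₑ A0 A1 A2 A3 *ₑ (K ·ₑ cubₑ B0 B1 B2 B3)) n := (cubₑ B0 B1 B2 B3 *ₑ (K ·ₑ cubₑ A0 A1 A2 A3)) n
    low : ∀ n → n ≤ 6 → _
    low 0 _ = solve 9 (commute 0) refl k a0 a1 a2 a3 b0 b1 b2 b3
    low 1 _ = solve 9 (commute 1) refl k a0 a1 a2 a3 b0 b1 b2 b3
    low 2 _ = solve 9 (commute 2) refl k a0 a1 a2 a3 b0 b1 b2 b3
    low 3 _ = solve 9 (commute 3) refl k a0 a1 a2 a3 b0 b1 b2 b3
    low 4 _ = solve 9 (commute 4) refl k a0 a1 a2 a3 b0 b1 b2 b3
    low 5 _ = solve 9 (commute 5) refl k a0 a1 a2 a3 b0 b1 b2 b3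
    low 6 _ = solve 9 (commute 6) refl k a0 a1 a2 a3 b0 b1 b2 b3
    low (suc (suc (suc (suc (suc (suc (suc _))))))) (s≤s (s≤s (s≤s (s≤s (s≤s (s≤s ()))))))

  ev-cub-0 : ∀ a0 a1 a2 a3 → ev (cub a0 a1 a2 a3) 0# ≈ a0
  ev-cub-0 = solve 4 (λ A0 A1 A2 A3 → evalₑ (cubₑ A0 A1 A2 A3) 3 (lit 0) := A0) refl

  ev-cub-1 : ∀ a0 a1 a2 a3 → ev (cub a0 a1 a2 a3) 1# ≈ a0 + a1 + a2 + a3
  ev-cub-1 = solve 4 (λ A0 A1 A2 A3 → evalₑ (cubₑ A0 A1 A2 A3) 3 (con (+ 1)) := value-at-1ₑ A0 A1 A2 A3) refl

module Coefficients {c ℓ : Level} (F : ACField0 c ℓ) (f : Theory.RatFun F) where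
  open ACField0 F
  open Theory F
  open FieldFacts F
  open IntegerCoefficients commRing
  open CoefficientExpressions commRing

  p0 p1 p2 p3 q0 q1 q2 q3 : Carrier
  p0 = P f 0
  p1 = P f 1
  p2 = P f 2
  p3 = P f 3
  q0 = Q f 0
  q1 = Q f 1
  q2 = Q f 2
  q3 = Q f 3

  -- the Wronskian P'Q - PQ' at 0, at 1 and at ∞ (its z⁴-coefficient)
  W₀ W₁ W∞ : Carrier
  W₀ = p1 * q0 - p0 * q1
  W₁ = slope-at-1 (P f) * value-at-1 (Q f) - value-at-1 (P f) * slope-at-1 (Q f)
  W∞ = p3 * q2 - p2 * q3

  critical-at-0 : Critical f (fin 0#) → W₀ ≈ 0#
  critical-at-0 = trans (sym (solve 8 (λ P0 P1 P2 P3 Q0 Q1 Q2 Q3 →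
    evalₑ (wronskianₑ (cubₑ P0 P1 P2 P3) (cubₑ Q0 Q1 Q2 Q3)) 4 (lit 0) := P1 :* Q0 :- P0 :* Q1)
    refl p0 p1 p2 p3 q0 q1 q2 q3))

  critical-at-1 : Critical f (fin 1#) → W₁ ≈ 0#
  critical-at-1 = trans (sym (solve 8 (λ P0 P1 P2 P3 Q0 Q1 Q2 Q3 →
    evalₑ (wronskianₑ (cubₑ P0 P1 P2 P3) (cubₑ Q0 Q1 Q2 Q3)) 4 (con (+ 1)) :=
    slope-at-1ₑ P0 P1 P2 P3 :* value-at-1ₑ Q0 Q1 Q2 Q3 :- value-at-1ₑ P0 P1 P2 P3 :* slope-at-1ₑ Q0 Q1 Q2 Q3)
    refl p0 p1 p2 p3 q0 q1 q2 q3))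

  critical-at-∞ : Critical f ∞ → W∞ ≈ 0#
  critical-at-∞ = trans (sym (solve 8 (λ P0 P1 P2 P3 Q0 Q1 Q2 Q3 →
    wronskianₑ (cubₑ P0 P1 P2 P3) (cubₑ Q0 Q1 Q2 Q3) 4 := P3 :* Q2 :- P2 :* Q3)
    refl p0 p1 p2 p3 q0 q1 q2 q3))

  pencil : Carrier → Carrier → Poly
  pencil s t = (s ·P P f) +P (t ·P Q f)

  pencil-value-at-1 : ∀ s t → value-at-1 (pencil s t) ≈ s * value-at-1 (P f) + t * value-at-1 (Q f)
  pencil-value-at-1 s t = solve 10 (λ S T P0 P1 P2 P3 Q0 Q1 Q2 Q3 →
    value-at-1ₑ (S :* P0 :+ T :* Q0) (S :* P1 :+ T :* Q1) (S :* P2 :+ T :* Q2) (S :* P3 :+ T :* Q3) :=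
    S :* value-at-1ₑ P0 P1 P2 P3 :+ T :* value-at-1ₑ Q0 Q1 Q2 Q3) refl s t p0 p1 p2 p3 q0 q1 q2 q3

  pencil-slope-at-1 : ∀ s t → slope-at-1 (pencil s t) ≈ s * slope-at-1 (P f) + t * slope-at-1 (Q f)
  pencil-slope-at-1 s t = solve 10 (λ S T P0 P1 P2 P3 Q0 Q1 Q2 Q3 →
    slope-at-1ₑ (S :* P0 :+ T :* Q0) (S :* P1 :+ T :* Q1) (S :* P2 :+ T :* Q2) (S :* P3 :+ T :* Q3) :=
    S :* slope-at-1ₑ P0 P1 P2 P3 :+ T :* slope-at-1ₑ Q0 Q1 Q2 Q3) refl s t p0 p1 p2 p3 q0 q1 q2 q3

  pencil-wronskian-at-1 : ∀ s t s′ t′ →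
    slope-at-1 (pencil s t) * value-at-1 (pencil s′ t′) - value-at-1 (pencil s t) * slope-at-1 (pencil s′ t′)
      ≈ (s * t′ - t * s′) * W₁
  pencil-wronskian-at-1 s t s′ t′ = begin
    slope-at-1 (pencil s t) * value-at-1 (pencil s′ t′) - value-at-1 (pencil s t) * slope-at-1 (pencil s′ t′)
      ≈⟨ +-cong (*-cong (pencil-slope-at-1 s t) (pencil-value-at-1 s′ t′))
                (-‿cong (*-cong (pencil-value-at-1 s t) (pencil-slope-at-1 s′ t′))) ⟩
    (s * y′ + t * z′) * (s′ * y + t′ * z) - (s * y + t * z) * (s′ * y′ + t′ * z′)
      ≈⟨ solve 8 (λ S T S′ T′ Y Z Y′ Z′ →
           (S :* Y′ :+ T :* Z′) :* (S′ :* Y :+ T′ :* Z) :- (S :* Y :+ T :* Z) :* (S′ :* Y′ :+ T′ :* Z′) :=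
           (S :* T′ :- T :* S′) :* (Y′ :* Z :- Y :* Z′)) refl s t s′ t′ y z y′ z′ ⟩
    (s * t′ - t * s′) * W₁ ∎
    where
    open import Relation.Binary.Reasoning.Setoid setoid
    y z y′ z′ : Carrier
    y = value-at-1 (P f)
    z = value-at-1 (Q f)
    y′ = slope-at-1 (P f)
    z′ = slope-at-1 (Q f)

  -- the pencil members A = q₀P - p₀Q and B = p₃Q - q₃P fix 0 and ∞
  A B : Poly
  A = pencil q0 (- p0)
  B = pencil (- q3) p3

  ν : Carrier
  ν = q0 * p3 - p0 * q3

  A₀≈0 : A 0 ≈ 0#
  A₀≈0 = solve 2 (λ P0 Q0 → Q0 :* P0 :+ :- P0 :* Q0 := lit 0) refl p0 q0

  A₁≈W₀ : A 1 ≈ W₀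
  A₁≈W₀ = solve 4 (λ P0 P1 Q0 Q1 → Q0 :* P1 :+ :- P0 :* Q1 := P1 :* Q0 :- P0 :* Q1) refl p0 p1 q0 q1

  A₃≈ν : A 3 ≈ ν
  A₃≈ν = solve 4 (λ P0 P3 Q0 Q3 → Q0 :* P3 :+ :- P0 :* Q3 := Q0 :* P3 :- P0 :* Q3) refl p0 p3 q0 q3

  B₀≈ν : B 0 ≈ ν
  B₀≈ν = solve 4 (λ P0 P3 Q0 Q3 → :- Q3 :* P0 :+ P3 :* Q0 := Q0 :* P3 :- P0 :* Q3) refl p0 p3 q0 q3

  B₂≈W∞ : B 2 ≈ W∞
  B₂≈W∞ = solve 4 (λ P2 P3 Q2 Q3 → :- Q3 :* P2 :+ P3 :* Q2 := P3 :* Q2 :- P2 :* Q3) refl p2 p3 q2 q3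

  B₃≈0 : B 3 ≈ 0#
  B₃≈0 = solve 2 (λ P3 Q3 → :- Q3 :* P3 :+ P3 :* Q3 := lit 0) refl p3 q3

module CubicPencil {c ℓ : Level} (F : ACField0 c ℓ) (f : Theory.RatFun F) (cubic : Theory.IsCubic F f) where
  open ACField0 F
  open Theory F
  open FieldFacts F
  open Polynomials F
  open Coefficients F f
  open IntegerCoefficients commRing
  open CoefficientExpressions commRing

  leading : ¬ (p3 ≈ 0# × q3 ≈ 0#)
  leading = proj₁ cubic

  coprime : ∀ x → ¬ (ev (P f) x ≈ 0# × ev (Q f) x ≈ 0#)
  coprime = proj₂ cubic

  coprime-at-0 : ¬ (p0 ≈ 0# × q0 ≈ 0#)
  coprime-at-0 (p0≈0 , q0≈0) = coprime 0# (trans (ev-cub-0 p0 p1 p2 p3) p0≈0 , trans (ev-cub-0 q0 q1 q2 q3) q0≈0)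

  coprime-at-1 : ¬ (value-at-1 (P f) ≈ 0# × value-at-1 (Q f) ≈ 0#)
  coprime-at-1 (P₁≈0 , Q₁≈0) = coprime 1# (trans (ev-cub-1 p0 p1 p2 p3) P₁≈0 , trans (ev-cub-1 q0 q1 q2 q3) Q₁≈0)

  pencil-eval : ∀ s t x → s * ev (P f) x + t * ev (Q f) x ≈ ev (pencil s t) x
  pencil-eval s t x = solve 11 (λ S T X P0 P1 P2 P3 Q0 Q1 Q2 Q3 →
    S :* evalₑ (cubₑ P0 P1 P2 P3) 3 X :+ T :* evalₑ (cubₑ Q0 Q1 Q2 Q3) 3 X :=
    evalₑ (cubₑ (pencilₑ S T P0 Q0) (pencilₑ S T P1 Q1) (pencilₑ S T P2 Q2) (pencilₑ S T P3 Q3)) 3 X)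
    refl s t x p0 p1 p2 p3 q0 q1 q2 q3

  pencil-independent : ∀ {s t} → ¬ (s ≈ 0# × t ≈ 0#) → (∀ i → i ≤ 3 → pencil s t i ≈ 0#) → ⊥
  pencil-independent {s} {t} st≉0 r≈0 = byCases p₃≈0 p₃≉0
    where
    r₃≈0 : s * p3 + t * q3 ≈ 0#
    r₃≈0 = r≈0 3 (s≤s (s≤s (s≤s z≤n)))
    vanishes : ∀ x → s * ev (P f) x + t * ev (Q f) x ≈ 0#
    vanishes x = trans (pencil-eval s t x)
      (sum≈0 (r≈0 0 z≤n) (mulˡ≈0 x (sum≈0 (r≈0 1 (s≤s z≤n)) (mulˡ≈0 x (sum≈0 (r≈0 2 (s≤s (s≤s z≤n))) (mulˡ≈0 x r₃≈0))))))
    -- P has a root x; there t·Q(x) = 0, so t = 0 by coprimality, and then s·p₃ = 0 gives s = 0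
    p₃≉0 : ¬ (p3 ≈ 0#) → ⊥
    p₃≉0 p3≉0 with algClosed 2 (P f) p3≉0
    ... | x , Px≈0 = byCases
      (λ t≈0 → p3≉0 (cancelˡ (λ s≈0 → st≉0 (s≈0 , t≈0)) (sum≈0-cancelʳ r₃≈0 (mulʳ≈0 q3 t≈0))))
      (λ t≉0 → coprime x (Px≈0 , cancelˡ t≉0 (sum≈0-cancelˡ (vanishes x) (mulˡ≈0 s Px≈0))))
    -- symmetrically with a root of Q, which has degree 3 when p₃ = 0
    p₃≈0 : p3 ≈ 0# → ⊥
    p₃≈0 p3≈0 with algClosed 2 (Q f) (λ q3≈0 → leading (p3≈0 , q3≈0))
    ... | x , Qx≈0 = byCases
      (λ s≈0 → leading (p3≈0 , cancelˡ (λ t≈0 → st≉0 (s≈0 , t≈0)) (sum≈0-cancelˡ r₃≈0 (mulʳ≈0 p3 s≈0))))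
      (λ s≉0 → coprime x (cancelˡ s≉0 (sum≈0-cancelʳ (vanishes x) (mulˡ≈0 t Qx≈0)) , Qx≈0))

  -- if R = s·P + t·Q has R(1) = 0 ≠ R'(1), then R'(1)·P(1) = -t·W₁ and R'(1)·Q(1) = s·W₁,
  -- so W₁ = 0 would give a common zero of P and Q at 1
  no-simple-zero-at-1 : ∀ {s t} → W₁ ≈ 0# → value-at-1 (pencil s t) ≈ 0# → ¬ (slope-at-1 (pencil s t) ≈ 0#) → ⊥
  no-simple-zero-at-1 {s} {t} W₁≈0 r≈0 r′≉0 = coprime-at-1 (cancelˡ r′≉0 (trans (*-congʳ r′≈) P-identity) ,
                                                           cancelˡ r′≉0 (trans (*-congʳ r′≈) Q-identity))
    where
    y z y′ z′ : Carrier
    y = value-at-1 (P f)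
    z = value-at-1 (Q f)
    y′ = slope-at-1 (P f)
    z′ = slope-at-1 (Q f)
    r′≈ : slope-at-1 (pencil s t) ≈ s * y′ + t * z′
    r′≈ = pencil-slope-at-1 s t
    sy+tz≈0 : s * y + t * z ≈ 0#
    sy+tz≈0 = trans (sym (pencil-value-at-1 s t)) r≈0
    P-identity : (s * y′ + t * z′) * y ≈ 0#
    P-identity = trans (solve 6 (λ S T Y Z Y′ Z′ →
      (S :* Y′ :+ T :* Z′) :* Y := (S :* Y :+ T :* Z) :* Y′ :- T :* (Y′ :* Z :- Y :* Z′)) refl s t y z y′ z′)
      (diff≈0 (mulʳ≈0 y′ sy+tz≈0) (mulˡ≈0 t W₁≈0))
    Q-identity : (s * y′ + t * z′) * z ≈ 0#
    Q-identity = trans (solve 6 (λ S T Y Z Y′ Z′ →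
      (S :* Y′ :+ T :* Z′) :* Z := (S :* Y :+ T :* Z) :* Z′ :+ S :* (Y′ :* Z :- Y :* Z′)) refl s t y z y′ z′)
      (sum≈0 (mulʳ≈0 z′ sy+tz≈0) (mulˡ≈0 s W₁≈0))

  -- a nontrivial pencil member vanishing at the critical point 1 cannot also have
  -- both lower or both upper coefficients zero (it would be (z-1)²·0)
  pencil-vanishing-at-1 : ∀ {s t} → W₁ ≈ 0# → ¬ (s ≈ 0# × t ≈ 0#) → value-at-1 (pencil s t) ≈ 0# →
    (pencil s t 0 ≈ 0# × pencil s t 1 ≈ 0#) ⊎ (pencil s t 2 ≈ 0# × pencil s t 3 ≈ 0#) → ⊥
  pencil-vanishing-at-1 W₁≈0 st≉0 r≈0 two-coefficients = byCases
    (λ r′≈0 → pencil-independent st≉0 (double-zero-at-1 _ r≈0 r′≈0 two-coefficients))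
    (no-simple-zero-at-1 W₁≈0 r≈0)

-- Writing σ = (a, b; c, d), N' = z²(z+u') and D' = e₀ + e₁z, the equivalence
-- says D'·(dP - bQ) = N'·(aQ - cP): the pencil member dP - bQ is divisible by
-- N', and the determinant ad - bc ≠ 0 transfers this to A.
module Uniqueness {c ℓ : Level} (F : ACField0 c ℓ) (f : Theory.RatFun F) where
  open ACField0 F
  open Theory F
  open FieldFacts F
  open Coefficients F f
  open IntegerCoefficients commRing
  open CoefficientExpressions commRing

  defect : (a b c d u : Carrier) → ℕ → Carrier
  defect a b c d u n =
    (P f *P ((c ·P P (fᵤ u)) +P (d ·P Q (fᵤ u)))) n - (Q f *P ((a ·P P (fᵤ u)) +P (b ·P Q (fᵤ u)))) n

  defectₑ : ∀ {m} (A B C D U P0 P1 P2 P3 Q0 Q1 Q2 Q3 : Polynomial m) → ℕ → Polynomial m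
  defectₑ A B C D U P0 P1 P2 P3 Q0 Q1 Q2 Q3 =
    (cubₑ P0 P1 P2 P3 *ₑ ((C ·ₑ N) +ₑ (D ·ₑ Den))) -ₑ (cubₑ Q0 Q1 Q2 Q3 *ₑ ((A ·ₑ N) +ₑ (B ·ₑ Den)))
    where
    N Den : ℕ → Polynomial _
    N = cubₑ (lit 0) (lit 0) U (con (+ 1))
    Den = linₑ (:- (U :+ lit 2)) (lit 2 :* U :+ lit 3)

  -- the defect is the coefficient sequence of D·(dP - bQ) - N·(aQ - cP); its coefficients
  -- of z⁰ and z¹ only involve the pencil member dP - bQ
  defect-0 : ∀ a b c d u → - (u + two) * pencil d (- b) 0 ≈ defect a b c d u 0
  defect-0 a b c d u = solve 13 (λ A B C D U P0 P1 P2 P3 Q0 Q1 Q2 Q3 →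
    (:- (U :+ lit 2)) :* pencilₑ D (:- B) P0 Q0 := defectₑ A B C D U P0 P1 P2 P3 Q0 Q1 Q2 Q3 0)
    refl a b c d u p0 p1 p2 p3 q0 q1 q2 q3

  defect-1 : ∀ a b c d u →
    - (u + two) * pencil d (- b) 1 ≈ defect a b c d u 1 - (two * u + three) * pencil d (- b) 0
  defect-1 a b c d u = solve 13 (λ A B C D U P0 P1 P2 P3 Q0 Q1 Q2 Q3 →
    (:- (U :+ lit 2)) :* pencilₑ D (:- B) P1 Q1 :=
    defectₑ A B C D U P0 P1 P2 P3 Q0 Q1 Q2 Q3 1 :- (lit 2 :* U :+ lit 3) :* pencilₑ D (:- B) P0 Q0)
    refl a b c d u p0 p1 p2 p3 q0 q1 q2 q3

  -- evaluating D·(dP - bQ) - N·(aQ - cP) at z = -u, where N vanishes, divided by u²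
  defect-at-u : ∀ a b c d u →
    (- (u + two) - u * (two * u + three)) * (pencil d (- b) 2 - u * pencil d (- b) 3) ≈
      defect a b c d u 2 - (two * u + three) * pencil d (- b) 1 - u * defect a b c d u 3
        + u * u * defect a b c d u 4 - u * u * u * defect a b c d u 5 + u * u * u * u * defect a b c d u 6
  defect-at-u a b c d u = solve 13 (λ A B C D U P0 P1 P2 P3 Q0 Q1 Q2 Q3 →
    let Δ = defectₑ A B C D U P0 P1 P2 P3 Q0 Q1 Q2 Q3 in
    ((:- (U :+ lit 2)) :- U :* (lit 2 :* U :+ lit 3)) :* (pencilₑ D (:- B) P2 Q2 :- U :* pencilₑ D (:- B) P3 Q3) :=
    Δ 2 :- (lit 2 :* U :+ lit 3) :* pencilₑ D (:- B) P1 Q1 :- U :* Δ 3 :+ U :* U :* Δ 4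
      :- U :* U :* U :* Δ 5 :+ U :* U :* U :* U :* Δ 6)
    refl a b c d u p0 p1 p2 p3 q0 q1 q2 q3

  -- (ad - bc)·A = (aQ - cP)(0)·(dP - bQ) - (dP - bQ)(0)·(aQ - cP), evaluated at -u, divided by u²
  determinant-identity : ∀ a b c d u →
    (a * d - b * c) * (A 2 - u * A 3) ≈
      pencil (- c) a 0 * (pencil d (- b) 2 - u * pencil d (- b) 3) - pencil d (- b) 0 * (pencil (- c) a 2 - u * pencil (- c) a 3)
  determinant-identity a b c d u = solve 11 (λ A B C D U P0 P2 P3 Q0 Q2 Q3 →
    (A :* D :- B :* C) :* (pencilₑ Q0 (:- P0) P2 Q2 :- U :* pencilₑ Q0 (:- P0) P3 Q3) :=
    pencilₑ (:- C) A P0 Q0 :* (pencilₑ D (:- B) P2 Q2 :- U :* pencilₑ D (:- B) P3 Q3)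
      :- pencilₑ D (:- B) P0 Q0 :* (pencilₑ (:- C) A P2 Q2 :- U :* pencilₑ (:- C) A P3 Q3))
    refl a b c d u p0 p2 p3 q0 q2 q3

  -- the coefficients -(u+2) and -(u+2) - u(2u+3) = -2(u+1)² are nonzero for admissible u
  denominator-0≉0 : ∀ {u} → Admissible u → ¬ (- (u + two) ≈ 0#)
  denominator-0≉0 (_ , u≉-2) e≈0 = u≉-2 (x+y≈0⇒x≈-y (-x≈0⇒x≈0 e≈0))

  denominator-at-u≉0 : ∀ {u} → Admissible u → ¬ (- (u + two) - u * (two * u + three) ≈ 0#)
  denominator-at-u≉0 {u} (u≉-1 , _) e≈0 = u+1≉0 (cancelˡ u+1≉0 (cancelˡ (charZero 1) (-x≈0⇒x≈0 (trans square e≈0))))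
    where
    u+1≉0 : ¬ (u + 1# ≈ 0#)
    u+1≉0 u+1≈0 = u≉-1 (x+y≈0⇒x≈-y u+1≈0)
    square : - (two * ((u + 1#) * (u + 1#))) ≈ - (u + two) - u * (two * u + three)
    square = solve 1 (λ U → :- (lit 2 :* ((U :+ con (+ 1)) :* (U :+ con (+ 1)))) :=
                            (:- (U :+ lit 2)) :- U :* (lit 2 :* U :+ lit 3)) refl u

  fᵤ-equivalence-determines-u : ∀ {u′} → Admissible u′ → Equivalent f (fᵤ u′) → A 2 ≈ u′ * A 3
  fᵤ-equivalence-determines-u {u′} admissible′ (a , b , c′ , d , det≉0 , σ) =
    x-y≈0⇒x≈y (cancelˡ det≉0 (trans (determinant-identity a b c′ d u′)
                                     (diff≈0 (mulˡ≈0 _ pt-at-u′≈0) (mulʳ≈0 _ pt₀≈0))))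
    where
    Δ≈0 : ∀ n → defect a b c′ d u′ n ≈ 0#
    Δ≈0 n = x≈y⇒x-y≈0 (σ n)
    -- the pencil member dP - bQ vanishes to second order at 0 and vanishes at -u′
    pt₀≈0 : pencil d (- b) 0 ≈ 0#
    pt₀≈0 = cancelˡ (denominator-0≉0 admissible′) (trans (defect-0 a b c′ d u′) (Δ≈0 0))
    pt₁≈0 : pencil d (- b) 1 ≈ 0#
    pt₁≈0 = cancelˡ (denominator-0≉0 admissible′)
                    (trans (defect-1 a b c′ d u′) (diff≈0 (Δ≈0 1) (mulˡ≈0 _ pt₀≈0)))
    pt-at-u′≈0 : pencil d (- b) 2 - u′ * pencil d (- b) 3 ≈ 0#
    pt-at-u′≈0 = cancelˡ (denominator-at-u≉0 admissible′) (trans (defect-at-u a b c′ d u′)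
      (sum≈0 (diff≈0 (sum≈0 (diff≈0 (diff≈0 (Δ≈0 2) (mulˡ≈0 _ pt₁≈0)) (mulˡ≈0 u′ (Δ≈0 3)))
                            (mulˡ≈0 _ (Δ≈0 4)))
                     (mulˡ≈0 _ (Δ≈0 5)))
             (mulˡ≈0 _ (Δ≈0 6))))

module Existence {c ℓ : Level} (F : ACField0 c ℓ) (f : Theory.RatFun F) (cubic : Theory.IsCubic F f)
                 (critical-0 : Theory.Critical F f (Theory.fin (ACField0.0# F)))
                 (critical-1 : Theory.Critical F f (Theory.fin (ACField0.1# F)))
                 (critical-∞ : Theory.Critical F f Theory.∞) where
  open ACField0 F
  open Theory F
  open FieldFacts F
  open Polynomials F
  open Coefficients F f
  open CubicPencil F f cubic
  open IntegerCoefficients commRing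
  open import Relation.Binary.Reasoning.Setoid setoid

  W₁≈0 : W₁ ≈ 0#
  W₁≈0 = critical-at-1 critical-1

  -- criticality at 0 and ∞: A = z²(A₂ + A₃z) and B = B₀ + B₁z
  A₁≈0 : A 1 ≈ 0#
  A₁≈0 = trans A₁≈W₀ (critical-at-0 critical-0)

  B₂≈0 : B 2 ≈ 0#
  B₂≈0 = trans B₂≈W∞ (critical-at-∞ critical-∞)

  A-nontrivial : ¬ (q0 ≈ 0# × - p0 ≈ 0#)
  A-nontrivial (q0≈0 , -p0≈0) = coprime-at-0 (-x≈0⇒x≈0 -p0≈0 , q0≈0)

  B-nontrivial : ¬ (- q3 ≈ 0# × p3 ≈ 0#)
  B-nontrivial (-q3≈0 , p3≈0) = leading (p3≈0 , -x≈0⇒x≈0 -q3≈0)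

  -- ν = 0 would make A a multiple of z², forcing A = 0 or p₃ = q₃ = 0
  ν≉0 : ¬ (ν ≈ 0#)
  ν≉0 ν≈0 = byCases A₂≈0 A₂≉0
    where
    A₂≈0 : A 2 ≈ 0# → ⊥
    A₂≈0 A₂≈0-hyp = pencil-independent A-nontrivial (all-coefficients A₀≈0 A₁≈0 A₂≈0-hyp (trans A₃≈ν ν≈0))
    A₂≉0 : ¬ (A 2 ≈ 0#) → ⊥
    A₂≉0 A₂≉0-hyp = leading (cancelˡ A₂≉0-hyp (trans p-identity (diff≈0 (mulʳ≈0 p2 ν≈0) (mulʳ≈0 p0 W∞≈0))) ,
                          cancelˡ A₂≉0-hyp (trans q-identity (diff≈0 (mulʳ≈0 q2 ν≈0) (mulʳ≈0 q0 W∞≈0))))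
      where
      W∞≈0 : W∞ ≈ 0#
      W∞≈0 = critical-at-∞ critical-∞
      p-identity : A 2 * p3 ≈ ν * p2 - W∞ * p0
      p-identity = solve 6 (λ P0 P2 P3 Q0 Q2 Q3 →
        (Q0 :* P2 :+ :- P0 :* Q2) :* P3 := (Q0 :* P3 :- P0 :* Q3) :* P2 :- (P3 :* Q2 :- P2 :* Q3) :* P0)
        refl p0 p2 p3 q0 q2 q3
      q-identity : A 2 * q3 ≈ ν * q2 - W∞ * q0
      q-identity = solve 6 (λ P0 P2 P3 Q0 Q2 Q3 →
        (Q0 :* P2 :+ :- P0 :* Q2) :* Q3 := (Q0 :* P3 :- P0 :* Q3) :* Q2 :- (P3 :* Q2 :- P2 :* Q3) :* Q0)
        refl p0 p2 p3 q0 q2 q3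

  A-at-1≉0 : ¬ (value-at-1 A ≈ 0#)
  A-at-1≉0 A-at-1≈0 = pencil-vanishing-at-1 W₁≈0 A-nontrivial A-at-1≈0 (inj₁ (A₀≈0 , A₁≈0))

  B-at-1≉0 : ¬ (value-at-1 B ≈ 0#)
  B-at-1≉0 B-at-1≈0 = pencil-vanishing-at-1 W₁≈0 B-nontrivial B-at-1≈0 (inj₂ (B₂≈0 , B₃≈0))

  A-B-wronskian : slope-at-1 A * value-at-1 B ≈ value-at-1 A * slope-at-1 B
  A-B-wronskian = x-y≈0⇒x≈y (trans (pencil-wronskian-at-1 q0 (- p0) (- q3) p3) (mulˡ≈0 _ W₁≈0))

  -- the scalings turning A into z²(z + u) and B into (2u+3)z - (u+2)
  α : Carrier
  α = proj₁ (inverse ν ν≉0)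

  α≉0 : ¬ (α ≈ 0#)
  α≉0 = inverse-nonzero (proj₂ (inverse ν ν≉0))

  αA₃≈1 : α * A 3 ≈ 1#
  αA₃≈1 = trans (*-congˡ A₃≈ν) (trans (*-comm α ν) (proj₂ (inverse ν ν≉0)))

  B-at-1⁻¹ : Carrier
  B-at-1⁻¹ = proj₁ (inverse (value-at-1 B) B-at-1≉0)

  β : Carrier
  β = value-at-1 A * B-at-1⁻¹ * α

  β≉0 : ¬ (β ≈ 0#)
  β≉0 = *-nonzero (*-nonzero A-at-1≉0 (inverse-nonzero (proj₂ (inverse (value-at-1 B) B-at-1≉0)))) α≉0

  u : Carrier
  u = α * A 2

  αA-at-1 : α * value-at-1 A ≈ u + 1#
  αA-at-1 = trans (solve 5 (λ Z X0 X1 X2 X3 → Z :* (X0 :+ X1 :+ X2 :+ X3) := Z :* X0 :+ Z :* X1 :+ Z :* X2 :+ Z :* X3)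
                          refl α (A 0) (A 1) (A 2) (A 3))
                  (+-cong (trans (+-congʳ (sum≈0 (mulˡ≈0 α A₀≈0) (mulˡ≈0 α A₁≈0))) (+-identityˡ u)) αA₃≈1)

  αA-slope-at-1 : α * slope-at-1 A ≈ two * u + three
  αA-slope-at-1 = begin
    α * slope-at-1 A                                 ≈⟨ solve 4 (λ Z X1 X2 X3 →
      Z :* (X1 :+ lit 2 :* X2 :+ lit 3 :* X3) := Z :* X1 :+ lit 2 :* (Z :* X2) :+ lit 3 :* (Z :* X3)) refl α (A 1) (A 2) (A 3) ⟩
    α * A 1 + two * u + three * (α * A 3)             ≈⟨ +-cong (+-congʳ (mulˡ≈0 α A₁≈0)) (*-congˡ αA₃≈1) ⟩
    0# + two * u + three * 1#                        ≈⟨ solve 1 (λ U → lit 0 :+ lit 2 :* U :+ lit 3 :* con (+ 1) := lit 2 :* U :+ lit 3) refl u ⟩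
    two * u + three                                  ∎

  βB-at-1 : β * value-at-1 B ≈ u + 1#
  βB-at-1 = begin
    (value-at-1 A * B-at-1⁻¹ * α) * value-at-1 B    ≈⟨ solve 4 (λ X Y Z W → (X :* Y :* Z) :* W := (W :* Y) :* (Z :* X))
                                                          refl (value-at-1 A) B-at-1⁻¹ α (value-at-1 B) ⟩
    (value-at-1 B * B-at-1⁻¹) * (α * value-at-1 A)  ≈⟨ *-cong (proj₂ (inverse (value-at-1 B) B-at-1≉0)) αA-at-1 ⟩
    1# * (u + 1#)                                  ≈⟨ *-identityˡ _ ⟩
    u + 1#                                         ∎

  βB₁ : β * B 1 ≈ two * u + three
  βB₁ = begin
    (value-at-1 A * B-at-1⁻¹ * α) * B 1             ≈⟨ *-congˡ (sym B-slope-at-1) ⟩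
    (value-at-1 A * B-at-1⁻¹ * α) * slope-at-1 B    ≈⟨ solve 4 (λ X Y Z W → (X :* Y :* Z) :* W := (Y :* Z) :* (X :* W))
                                                          refl (value-at-1 A) B-at-1⁻¹ α (slope-at-1 B) ⟩
    (B-at-1⁻¹ * α) * (value-at-1 A * slope-at-1 B)  ≈⟨ *-congˡ (sym A-B-wronskian) ⟩
    (B-at-1⁻¹ * α) * (slope-at-1 A * value-at-1 B)  ≈⟨ solve 4 (λ Y Z X W → (Y :* Z) :* (X :* W) := (W :* Y) :* (Z :* X))
                                                          refl B-at-1⁻¹ α (slope-at-1 A) (value-at-1 B) ⟩
    (value-at-1 B * B-at-1⁻¹) * (α * slope-at-1 A)  ≈⟨ *-cong (proj₂ (inverse (value-at-1 B) B-at-1≉0)) αA-slope-at-1 ⟩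
    1# * (two * u + three)                         ≈⟨ *-identityˡ _ ⟩
    two * u + three                                ∎
    where
    B-slope-at-1 : slope-at-1 B ≈ B 1
    B-slope-at-1 = trans (+-cong (+-congˡ (mulˡ≈0 _ B₂≈0)) (mulˡ≈0 _ B₃≈0))
                         (solve 1 (λ X → X :+ lit 0 :+ lit 0 := X) refl (B 1))

  βB₀ : β * B 0 ≈ - (u + two)
  βB₀ = begin
    β * B 0                                        ≈⟨ solve 5 (λ Z X0 X1 X2 X3 →
      Z :* X0 := Z :* (X0 :+ X1 :+ X2 :+ X3) :- Z :* X1 :- Z :* X2 :- Z :* X3) refl β (B 0) (B 1) (B 2) (B 3) ⟩
    β * value-at-1 B - β * B 1 - β * B 2 - β * B 3  ≈⟨ +-cong (+-cong (+-cong βB-at-1 (-‿cong βB₁)) (-‿cong (mulˡ≈0 β B₂≈0)))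
                                                            (-‿cong (mulˡ≈0 β B₃≈0)) ⟩
    (u + 1#) - (two * u + three) - 0# - 0#          ≈⟨ solve 1 (λ U → (U :+ con (+ 1)) :- (lit 2 :* U :+ lit 3) :- lit 0 :- lit 0 :=
                                                                  :- (U :+ lit 2)) refl u ⟩
    - (u + two)                                    ∎

  -- u ≠ -1 since A(1) ≠ 0, and u ≠ -2 since B₀ = ν ≠ 0
  admissible : Admissible u
  admissible = (λ u≈-1 → A-at-1≉0 (cancelˡ α≉0 (trans αA-at-1 (trans (+-congʳ u≈-1) (-‿inverseˡ 1#))))) ,
               (λ u≈-2 → ν≉0 (trans (sym B₀≈ν) (cancelˡ β≉0 (trans βB₀ (trans (-‿cong (+-congʳ u≈-2)) (solve 0 (:- (:- lit 2 :+ lit 2) := lit 0) refl))))))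

  numerator : P (fᵤ u) ≈P (α ·P A)
  numerator 0 = sym (mulˡ≈0 α A₀≈0)
  numerator 1 = sym (mulˡ≈0 α A₁≈0)
  numerator 2 = refl
  numerator 3 = sym αA₃≈1
  numerator (suc (suc (suc (suc _)))) = sym (mulˡ≈0 α (sum≈0 (zeroʳ q0) (zeroʳ (- p0))))

  denominator : Q (fᵤ u) ≈P (β ·P B)
  denominator 0 = sym βB₀
  denominator 1 = sym βB₁
  denominator 2 = sym (mulˡ≈0 β B₂≈0)
  denominator 3 = sym (mulˡ≈0 β B₃≈0)
  denominator (suc (suc (suc (suc _)))) = sym (mulˡ≈0 β (sum≈0 (zeroʳ (- q3)) (zeroʳ p3)))

  -- σ inverts (P, Q) ↦ (α·A, β·B) up to the factor κ = αβν
  κ : Carrier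
  κ = α * β * ν

  recover-P : (((β * p3) ·P P (fᵤ u)) +P ((α * p0) ·P Q (fᵤ u))) ≈P (κ ·P P f)
  recover-P i = trans (+-cong (*-congˡ (numerator i)) (*-congˡ (denominator i)))
    (solve 8 (λ X Y P0 P3 Q0 Q3 Pi Qi →
       (Y :* P3) :* (X :* (Q0 :* Pi :+ :- P0 :* Qi)) :+ (X :* P0) :* (Y :* (:- Q3 :* Pi :+ P3 :* Qi)) :=
       X :* Y :* (Q0 :* P3 :- P0 :* Q3) :* Pi) refl α β p0 p3 q0 q3 (P f i) (Q f i))

  recover-Q : (((β * q3) ·P P (fᵤ u)) +P ((α * q0) ·P Q (fᵤ u))) ≈P (κ ·P Q f)
  recover-Q i = trans (+-cong (*-congˡ (numerator i)) (*-congˡ (denominator i)))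
    (solve 8 (λ X Y P0 P3 Q0 Q3 Pi Qi →
       (Y :* Q3) :* (X :* (Q0 :* Pi :+ :- P0 :* Qi)) :+ (X :* Q0) :* (Y :* (:- Q3 :* Pi :+ P3 :* Qi)) :=
       X :* Y :* (Q0 :* P3 :- P0 :* Q3) :* Qi) refl α β p0 p3 q0 q3 (P f i) (Q f i))

  f∼fᵤ : Equivalent f (fᵤ u)
  f∼fᵤ = β * p3 , α * p0 , β * q3 , α * q0 , det≉0 , λ n → begin
    (P f *P (((β * q3) ·P P (fᵤ u)) +P ((α * q0) ·P Q (fᵤ u)))) n  ≈⟨ *P-congʳ (P f) recover-Q n ⟩
    (P f *P (κ ·P Q f)) n                                      ≈⟨ cub-*P-comm κ p0 p1 p2 p3 q0 q1 q2 q3 n ⟩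
    (Q f *P (κ ·P P f)) n                                      ≈⟨ *P-congʳ (Q f) recover-P n ⟨
    (Q f *P (((β * p3) ·P P (fᵤ u)) +P ((α * p0) ·P Q (fᵤ u)))) n  ∎
    where
    det≉0 : ¬ ((β * p3) * (α * q0) - (α * p0) * (β * q3) ≈ 0#)
    det≉0 det≈0 = *-nonzero (*-nonzero α≉0 β≉0) ν≉0 (trans (solve 6 (λ X Y P0 P3 Q0 Q3 →
      X :* Y :* (Q0 :* P3 :- P0 :* Q3) := (Y :* P3) :* (X :* Q0) :- (X :* P0) :* (Y :* Q3)) refl α β p0 p3 q0 q3) det≈0)

  unique : ∀ u′ → Admissible u′ → Equivalent f (fᵤ u′) → u′ ≈ u
  unique u′ admissible′ f∼fᵤ′ = sym (begin
    α * A 2            ≈⟨ *-congˡ (Uniqueness.fᵤ-equivalence-determines-u F f admissible′ f∼fᵤ′) ⟩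
    α * (u′ * A 3)      ≈⟨ solve 3 (λ X U Y → X :* (U :* Y) := U :* (X :* Y)) refl α u′ (A 3) ⟩
    u′ * (α * A 3)      ≈⟨ *-congˡ αA₃≈1 ⟩
    u′ * 1#            ≈⟨ *-identityʳ u′ ⟩
    u′                 ∎)

module CriticalPointsOfFᵤ {c ℓ : Level} (F : ACField0 c ℓ) where
  open ACField0 F
  open Theory F
  open Polynomials F
  open IntegerCoefficients commRing
  open CoefficientExpressions commRing

  fᵤ-critical-points : ∀ u → CriticalPoints-0-1-∞-φ u
  fᵤ-critical-points u = two , charZero 1 , ≈P-from-low 3 wronskian-degree factored-degree low
    where
    denominator-degree : DegreeAtMost 1 (Q (fᵤ u))
    denominator-degree = lin-degree (- (u + two)) (two * u + three)
    wronskian-degree : DegreeAtMost 3 (wronskian (fᵤ u))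
    wronskian-degree = -P-degree (*P-degree {2} {1} (deriv-degree (cub-degree 0# 0# u 1#)) denominator-degree)
                                 (*P-degree {3} {0} (cub-degree 0# 0# u 1#) (deriv-degree denominator-degree))
    factored-degree : DegreeAtMost 3 (two ·P ((lin 0# 1# *P lin (- 1#) 1#) *P lin (u * u + two * u) (two * u + three)))
    factored-degree = ·P-degree two (*P-degree {2} {1} (*P-degree {1} {1} (lin-degree _ _) (lin-degree _ _)) (lin-degree _ _))
    coefficient : ℕ → N-ary 1 (Polynomial 1) (Polynomial 1 × Polynomial 1)
    coefficient n U =
      wronskianₑ (cubₑ (lit 0) (lit 0) U one) (linₑ (:- (U :+ lit 2)) (lit 2 :* U :+ lit 3)) n :=
      (lit 2 ·ₑ ((linₑ (lit 0) one *ₑ linₑ (:- one) one) *ₑ linₑ (U :* U :+ lit 2 :* U) (lit 2 :* U :+ lit 3))) n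
      where
      one : Polynomial 1
      one = con (+ 1)
    low : ∀ n → n ≤ 3 → _
    low 0 _ = solve 1 (coefficient 0) refl u
    low 1 _ = solve 1 (coefficient 1) refl u
    low 2 _ = solve 1 (coefficient 2) refl u
    low 3 _ = solve 1 (coefficient 3) refl u
    low (suc (suc (suc (suc _)))) (s≤s (s≤s (s≤s ())))

mainTheorem5 : ∀ {c ℓ : Level} (F : ACField0 c ℓ) →
    let open ACField0 F in
    let open Theory F in
    (∀ (f : RatFun) → IsCubic f →
       Critical f (fin 0#) → Critical f (fin 1#) → Critical f ∞ →
       Σ Carrier λ u → Admissible u × Equivalent f (fᵤ u) ×
         (∀ u′ → Admissible u′ → Equivalent f (fᵤ u′) → u′ ≈ u))
    × (∀ (u : Carrier) → Admissible u → CriticalPoints-0-1-∞-φ u)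
mainTheorem5 F =
  (λ f cubic critical-0 critical-1 critical-∞ →
     let open Existence F f cubic critical-0 critical-1 critical-∞ in
     u , admissible , f∼fᵤ , unique) ,
  (λ u _ → CriticalPointsOfFᵤ.fᵤ-critical-points F u)
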